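{- Let $K\ge7$, $c\ge1$ and $0\le\gamma\le6$ be integers. Let $\lambda,\mu$ be integers with $\lambda\ge -2c+\lambda_0(\gamma)$ and $\mu\ge -c+\mu_0(\gamma)$, where $(\lambda_0(0),\dots,\lambda_0(6))=(2,1,4,3,2,1,0)$ and $(\mu_0(0),\dots,\mu_0(6))=(0,0,3,2,1,0,-1)$. Set $L=K-7c-\gamma$ and $M=K+L+5$. Let $a_1,\dots,a_L$ be arbitrary integers, and let $B_C$ be the sequence with $B_C(n)=0$ for all integers $n\le0$, with first $K+L+4$ terms given by \[1,2,\dots,K,\ 6,\ a_1,a_2,\dots,a_L,\ 2K+\lambda-2,\ 2K+\mu-1,\ K-2\] (so $B_C(i)=i$ for $1\le i\le K$, $B_C(K+1)=6$, $B_C(K+1+j)=a_j$, $B_C(M-3)=2K+\lambda-2$, $B_C(M-2)=2K+\mu-1$, $B_C(M-1)=K-2$), and for $n\ge M$ \[B_C(n)=B_C\bigl(n-B_C(n-1)\bigr)+B_C\bigl(n-B_C(n-2)\bigr)+B_C\bigl(n-B_C(n-3)\bigr).\] Let $\nu=-2,-2,2,1,0,-1,-2$ according as $\gamma=0,1,2,3,4,5,6$ respectively. Then for every integer $n$ with $M-3\le n\le 2K+\nu$, writing $n=M+7k+r$ with $k$ an integer and $0\le r\le6$, the term $B_C(n)$ is defined and \[B_C(M+7k)=L+7k+7,\quad B_C(M+7k+1)=M+7k+2,\quad B_C(M+7k+2)=M+7k+4,\quad B_C(M+7k+3)=7,\] \[B_C(M+7k+4)=2K+2k+\lambda,\quad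 B_C(M+7k+5)=2K+k+\mu,\quad B_C(M+7k+6)=K-2.\]
   Context: In evaluating the recurrence, terms at nonpositive indices have value $0$; a term $B_C(n)$ is defined when all earlier terms are defined and each index $n-B_C(n-i)$, $i=1,2,3$, is at most $n-1$. -}

module Defs where

open import Data.Nat as ℕ using (ℕ; zero; suc)
open import Data.Integer using (ℤ; +_; -[1+_]; _+_; _-_; _*_; _≤?_; -_)
open import Data.List using (List; []; _∷_; _++_; [_]; length; map; upTo)
open import Data.Vec as Vec using (Vec)
open import Data.Fin using (Fin; zero; suc)
open import Data.Maybe using (Maybe; just; nothing; _>>=_; maybe′)
open import Data.Bool using (if_then_else_)
open import Relation.Nullary.Decidable using (⌊_⌋)

nth : List ℤ → ℕ → Maybe ℤ
nth []       _       = nothing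
nth (x ∷ xs) zero    = just x
nth (x ∷ xs) (suc j) = nth xs j

-- given xs = [B(1), ..., B(m)], the value B(j) for an integer index j ≤ m
-- (terms at nonpositive indices are 0)
term : List ℤ → ℤ → Maybe ℤ
term xs (+ zero)  = just (+ 0)
term xs -[1+ _ ]  = just (+ 0)
term xs (+ suc j) = nth xs j

-- the summand B(n - B(n-i)), defined only when B(n-i) ≥ 1,
-- i.e. when the index n - B(n-i) is at most n-1
summand : List ℤ → ℤ → ℕ → Maybe ℤ
summand xs n i =
  term xs (n - + i) >>= λ v →
  if ⌊ + 1 ≤? v ⌋ then term xs (n - v) else nothing

recStep : List ℤ → Maybe ℤ
recStep xs =
  let n = + suc (length xs) in
  summand xs n 1 >>= λ s₁ →
  summand xs n 2 >>= λ s₂ →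
  summand xs n 3 >>= λ s₃ →
  just (s₁ + s₂ + s₃)

prefix : List ℤ → ℕ → Maybe (List ℤ)
prefix init zero    = just []
prefix init (suc m) =
  prefix init m >>= λ xs →
  maybe′ (λ v → just (xs ++ [ v ]))
         (recStep xs >>= λ v → just (xs ++ [ v ]))
         (nth init m)

-- B(n) for integer n: just v when defined with value v, nothing when undefined
B : List ℤ → ℤ → Maybe ℤ
B init (+ zero)  = just (+ 0)
B init -[1+ _ ]  = just (+ 0)
B init (+ suc m) = prefix init (suc m) >>= λ xs → term xs (+ suc m)

λ₀ : Fin 7 → ℤ
λ₀ zero = + 2
λ₀ (suc zero) = + 1
λ₀ (suc (suc zero)) = + 4
λ₀ (suc (suc (suc zero))) = + 3
λ₀ (suc (suc (suc (suc zero)))) = + 2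
λ₀ (suc (suc (suc (suc (suc zero))))) = + 1
λ₀ (suc (suc (suc (suc (suc (suc zero)))))) = + 0

μ₀ : Fin 7 → ℤ
μ₀ zero = + 0
μ₀ (suc zero) = + 0
μ₀ (suc (suc zero)) = + 3
μ₀ (suc (suc (suc zero))) = + 2
μ₀ (suc (suc (suc (suc zero)))) = + 1
μ₀ (suc (suc (suc (suc (suc zero))))) = + 0
μ₀ (suc (suc (suc (suc (suc (suc zero)))))) = - + 1

ν : Fin 7 → ℤ
ν zero = - + 2
ν (suc zero) = - + 2
ν (suc (suc zero)) = + 2
ν (suc (suc (suc zero))) = + 1
ν (suc (suc (suc (suc zero)))) = + 0
ν (suc (suc (suc (suc (suc zero))))) = - + 1
ν (suc (suc (suc (suc (suc (suc zero)))))) = - + 2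

initial : (K L : ℕ) → Vec ℤ L → (l m : ℤ) → List ℤ
initial K L a l m =
  map (λ i → + suc i) (upTo K) ++ [ + 6 ] ++ Vec.toList a ++
  (+ 2 * + K + l - + 2) ∷ (+ 2 * + K + m - + 1) ∷ (+ K - + 2) ∷ []

-- claimed value of B(M+7k+r), M = K+L+5
expected : (K L : ℕ) → (l m k : ℤ) → Fin 7 → ℤ
expected K L l m k zero = + L + + 7 * k + + 7
expected K L l m k (suc zero) = + K + + L + + 5 + + 7 * k + + 2
expected K L l m k (suc (suc zero)) = + K + + L + + 5 + + 7 * k + + 4
expected K L l m k (suc (suc (suc zero))) = + 7
expected K L l m k (suc (suc (suc (suc zero)))) = + 2 * + K + + 2 * k + l
expected K L l m k (suc (suc (suc (suc (suc zero))))) = + 2 * + K + k + m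
expected K L l m k (suc (suc (suc (suc (suc (suc zero)))))) = + K - + 2

-- From index M - 3 on, B_C follows the closed form `expected`: periodic in the residue r of
-- n = M + 7k + r and affine in the block index k.  So it suffices to extend the initial terms by
-- the closed form and to check the recurrence at every index of the range.  There each summand
-- B(n - B(n - i)) lands either in the current or the previous block, or in the initial segment
-- B(x) = x (1 ≤ x ≤ K), B(K + 1) = 6, or at an index ≤ 0 where B vanishes, and which of these
-- happens depends only on r.  The lower bounds on λ and μ make the indices n - (2K + 2k + λ) and
-- n - (2K + k + μ) nonpositive, and n ≤ 2K + ν keeps the lookups L + 7k + 7 + r (r ≤ 2) into the
-- initial segment at most K; in the last block reached these become conditions on γ.
module Submission where

open import Defs
open import Data.Nat as ℕ using (ℕ; zero; suc; z≤n; s≤s)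
import Data.Nat.Properties as ℕ
open import Data.Nat.DivMod using (_/_; _%_; _mod_; +-distrib-/; m<n⇒m/n≡0; m*n/n≡m; m<n⇒m%n≡m; m*n%n≡0;
  [m+kn]%n≡m%n; m≡m%n+[m/n]*n)
import Data.Nat.Tactic.RingSolver as ℕ-Solver
open import Data.Integer as ℤ using (ℤ; +_; -[1+_]; _+_; _-_; _*_; -_; _≤_; +≤+; -≤+)
import Data.Integer.Properties as ℤ
open import Data.Integer.Tactic.RingSolver using (solve; solve-∀)
open import Data.Fin using (Fin; zero; suc; toℕ; #_)
import Data.Fin.Properties as Fin
open import Data.List using (List; []; _∷_; _++_; length; map; upTo; applyUpTo)
open import Data.List.Properties using (length-++; length-map; length-upTo; length-applyUpTo; map-upTo; applyUpTo-∷ʳ)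
open import Data.Vec as Vec using (Vec)
open import Data.Vec.Properties using (length-toList)
open import Data.Maybe using (just; nothing; fromMaybe)
open import Data.Sum using (_⊎_; inj₁; inj₂)
open import Data.Product using (Σ-syntax; _×_; _,_)
open import Data.Empty using (⊥-elim)
open import Function using (_∘_)
open import Relation.Nullary using (¬_; yes; no; contradiction)
open import Relation.Binary.PropositionalEquality using (_≡_; refl; sym; trans; cong; cong₂; subst; subst₂;
  module ≡-Reasoning)

nth-applyUpTo : ∀ (f : ℕ → ℤ) {m j} → j ℕ.< m → nth (applyUpTo f m) j ≡ just (f j)
nth-applyUpTo f {suc m} {zero}  _         = refl
nth-applyUpTo f {suc m} {suc j} (s≤s j<m) = nth-applyUpTo (f ∘ suc) j<m

nth-≥length : ∀ (xs : List ℤ) {j} → length xs ℕ.≤ j → nth xs j ≡ nothing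
nth-≥length []       _           = refl
nth-≥length (x ∷ xs) (s≤s len≤j) = nth-≥length xs len≤j

nth≡just-fromMaybe : ∀ (xs : List ℤ) d {j} → j ℕ.< length xs → nth xs j ≡ just (fromMaybe d (nth xs j))
nth≡just-fromMaybe (x ∷ xs) d {zero}  _           = refl
nth≡just-fromMaybe (x ∷ xs) d {suc j} (s≤s j<len) = nth≡just-fromMaybe xs d j<len

nth-++ˡ : ∀ (xs ys : List ℤ) {j} → j ℕ.< length xs → nth (xs ++ ys) j ≡ nth xs j
nth-++ˡ (x ∷ xs) ys {zero}  _         = refl
nth-++ˡ (x ∷ xs) ys {suc j} (s≤s j<n) = nth-++ˡ xs ys j<n

nth-++ʳ : ∀ (xs ys : List ℤ) j → nth (xs ++ ys) (length xs ℕ.+ j) ≡ nth ys j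
nth-++ʳ []       ys j = refl
nth-++ʳ (x ∷ xs) ys j = nth-++ʳ xs ys j

≤-transfer : ∀ {x y x′ y′} → x ≤ y → y′ - x′ ≡ y - x → x′ ≤ y′
≤-transfer x≤y eq = ℤ.0≤i-j⇒j≤i (subst (+ 0 ≤_) (sym eq) (ℤ.i≤j⇒0≤j-i x≤y))

1+m-i≤m : ∀ m {i} → + 1 ≤ i → + suc m - i ≤ + m
1+m-i≤m m 1≤i = ℤ.+-monoʳ-≤ (+ suc m) (ℤ.neg-mono-≤ 1≤i)

+[a*b+y] : ∀ a b y → + (a ℕ.* b ℕ.+ y) ≡ + a * + b + + y
+[a*b+y] a b y = cong (_+ + y) (ℤ.pos-* a b)

[r+q*7]/7≡q : ∀ q (r : Fin 7) → (toℕ r ℕ.+ q ℕ.* 7) / 7 ≡ q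
[r+q*7]/7≡q q r = begin
  (toℕ r ℕ.+ q ℕ.* 7) / 7   ≡⟨ +-distrib-/ (toℕ r) (q ℕ.* 7) no-carry ⟩
  toℕ r / 7 ℕ.+ q ℕ.* 7 / 7 ≡⟨ cong₂ ℕ._+_ (m<n⇒m/n≡0 (Fin.toℕ<n r)) (m*n/n≡m q 7) ⟩
  q                         ∎
  where
    open ≡-Reasoning
    no-carry : toℕ r % 7 ℕ.+ q ℕ.* 7 % 7 ℕ.< 7
    no-carry = subst (ℕ._< 7)
      (sym (trans (cong₂ ℕ._+_ (m<n⇒m%n≡m (Fin.toℕ<n r)) (m*n%n≡0 q 7)) (ℕ.+-identityʳ _))) (Fin.toℕ<n r)

[r+q*7]mod7≡r : ∀ q (r : Fin 7) → (toℕ r ℕ.+ q ℕ.* 7) mod 7 ≡ r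
[r+q*7]mod7≡r q r = Fin.toℕ-injective (begin
  toℕ ((toℕ r ℕ.+ q ℕ.* 7) mod 7) ≡⟨ Fin.toℕ-fromℕ< _ ⟩
  (toℕ r ℕ.+ q ℕ.* 7) % 7         ≡⟨ [m+kn]%n≡m%n (toℕ r) q 7 ⟩
  toℕ r % 7                       ≡⟨ m<n⇒m%n≡m (Fin.toℕ<n r) ⟩
  toℕ r                           ∎)
  where open ≡-Reasoning

u≡[u%7]+[u/7]*7 : ∀ u → u ≡ toℕ (u mod 7) ℕ.+ u / 7 ℕ.* 7
u≡[u%7]+[u/7]*7 u = trans (m≡m%n+[m/n]*n u 7) (cong (ℕ._+ u / 7 ℕ.* 7) (sym (Fin.toℕ-fromℕ< _)))

-- B agrees with any solution of the recurrence extending the initial terms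

VanishesOnNonpositive : (ℤ → ℤ) → Set
VanishesOnNonpositive F = ∀ {x} → x ≤ + 0 → F x ≡ + 0

record RecurrenceAt (F : ℤ → ℤ) (n : ℤ) : Set where
  field
    positive₁ : + 1 ≤ F (n - + 1)
    positive₂ : + 1 ≤ F (n - + 2)
    positive₃ : + 1 ≤ F (n - + 3)
    equation  : F n ≡ F (n - F (n - + 1)) + F (n - F (n - + 2)) + F (n - F (n - + 3))

firstTerms : (ℤ → ℤ) → ℕ → List ℤ
firstTerms F m = applyUpTo (λ j → F (+ suc j)) m

module _ {F : ℤ → ℤ} (vanishes : VanishesOnNonpositive F) where

  term-firstTerms : ∀ {m x} → x ≤ + m → term (firstTerms F m) x ≡ just (F x)
  term-firstTerms {x = + zero}   _         = cong just (sym (vanishes ℤ.≤-refl))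
  term-firstTerms {x = -[1+ _ ]} _         = cong just (sym (vanishes -≤+))
  term-firstTerms {x = + suc j}  (+≤+ j<m) = nth-applyUpTo _ j<m

  summand-firstTerms : ∀ m i → + 1 ≤ + i → + 1 ≤ F (+ suc m - + i) →
                       summand (firstTerms F m) (+ suc m) i ≡ just (F (+ suc m - F (+ suc m - + i)))
  summand-firstTerms m i 1≤i pos
    rewrite term-firstTerms (1+m-i≤m m 1≤i) with + 1 ℤ.≤? F (+ suc m - + i)
  ... | yes _  = term-firstTerms (1+m-i≤m m pos)
  ... | no 1≰v = contradiction pos 1≰v

  recStep-firstTerms : ∀ {m} → RecurrenceAt F (+ suc m) → recStep (firstTerms F m) ≡ just (F (+ suc m))
  recStep-firstTerms {m} rec
    rewrite length-applyUpTo (λ j → F (+ suc j)) m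
          | summand-firstTerms m 1 (+≤+ (s≤s z≤n)) (RecurrenceAt.positive₁ rec)
          | summand-firstTerms m 2 (+≤+ (s≤s z≤n)) (RecurrenceAt.positive₂ rec)
          | summand-firstTerms m 3 (+≤+ (s≤s z≤n)) (RecurrenceAt.positive₃ rec)
          = cong just (sym (RecurrenceAt.equation rec))

  module _ {init : List ℤ}
           (agrees : ∀ {j} → j ℕ.< length init → nth init j ≡ just (F (+ suc j))) where

    prefix-firstTerms : ∀ {m} → (∀ {j} → length init ℕ.≤ j → j ℕ.< m → RecurrenceAt F (+ suc j)) →
                        prefix init m ≡ just (firstTerms F m)
    prefix-firstTerms {zero}  _   = refl
    prefix-firstTerms {suc m} rec
      rewrite prefix-firstTerms (λ len≤j j<m → rec len≤j (ℕ.m<n⇒m<1+n j<m))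
      with m ℕ.<? length init
    ... | yes m<len rewrite agrees m<len = cong just (applyUpTo-∷ʳ _ m)
    ... | no m≮len
      rewrite nth-≥length init (ℕ.≮⇒≥ m≮len) | recStep-firstTerms (rec (ℕ.≮⇒≥ m≮len) (ℕ.n<1+n m))
      = cong just (applyUpTo-∷ʳ _ m)

    B≡F : ∀ {n} → (∀ {j} → length init ℕ.≤ j → + suc j ≤ n → RecurrenceAt F (+ suc j)) → B init n ≡ just (F n)
    B≡F {+ zero}   _   = cong just (sym (vanishes ℤ.≤-refl))
    B≡F { -[1+ _ ]} _  = cong just (sym (vanishes -≤+))
    B≡F {+ suc m}  rec
      rewrite prefix-firstTerms {suc m} (λ len≤j j<m → rec len≤j (+≤+ j<m)) = term-firstTerms ℤ.≤-refl

-- The closed form satisfies the recurrence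

-- `expected` with K and L as integers, so that the ring solver can treat them as variables.
closedForm : (K L l m k : ℤ) → Fin 7 → ℤ
closedForm K L l m k zero                                     = L + + 7 * k + + 7
closedForm K L l m k (suc zero)                               = K + L + + 5 + + 7 * k + + 2
closedForm K L l m k (suc (suc zero))                         = K + L + + 5 + + 7 * k + + 4
closedForm K L l m k (suc (suc (suc zero)))                   = + 7
closedForm K L l m k (suc (suc (suc (suc zero))))             = + 2 * K + + 2 * k + l
closedForm K L l m k (suc (suc (suc (suc (suc zero)))))       = + 2 * K + k + m
closedForm K L l m k (suc (suc (suc (suc (suc (suc zero)))))) = K - + 2

closedForm≡expected : ∀ K L l m k r → closedForm (+ K) (+ L) l m k r ≡ expected K L l m k r
closedForm≡expected K L l m k zero                                     = refl
closedForm≡expected K L l m k (suc zero)                               = refl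
closedForm≡expected K L l m k (suc (suc zero))                         = refl
closedForm≡expected K L l m k (suc (suc (suc zero)))                   = refl
closedForm≡expected K L l m k (suc (suc (suc (suc zero))))             = refl
closedForm≡expected K L l m k (suc (suc (suc (suc (suc zero)))))       = refl
closedForm≡expected K L l m k (suc (suc (suc (suc (suc (suc zero)))))) = refl

module BlockRecurrence (F : ℤ → ℤ) (K L l m : ℤ) (0≤L : + 0 ≤ L) (2≤K : + 2 ≤ K)
  (F-nonpos   : VanishesOnNonpositive F)
  (F-identity : ∀ {x} → + 1 ≤ x → x ≤ K → F x ≡ x)
  (F-K+1      : F (K + + 1) ≡ + 6)
  (F-initial  : ∀ r → 4 ℕ.≤ toℕ r → F (K + L + + 5 + + 7 * -[1+ 0 ] + + toℕ r) ≡ closedForm K L l m -[1+ 0 ] r)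
  (F-periodic : ∀ k r → + 0 ≤ k → F (K + L + + 5 + + 7 * k + + toℕ r) ≡ closedForm K L l m k r)
  where

  record Summand (n : ℤ) (i : ℕ) (w : ℤ) : Set where
    constructor mkSummand
    field
      value    : ℤ
      lookup   : F (n - + i) ≡ value
      positive : + 1 ≤ value
      result   : F (n - value) ≡ w

  fromSummands : ∀ {n w₁ w₂ w₃} → Summand n 1 w₁ → Summand n 2 w₂ → Summand n 3 w₃ →
                 ∀ w → F n ≡ w → w ≡ w₁ + w₂ + w₃ → RecurrenceAt F n
  fromSummands {n} (mkSummand _ lookup₁ pos₁ res₁) (mkSummand _ lookup₂ pos₂ res₂) (mkSummand _ lookup₃ pos₃ res₃)
               _ value sum = record
    { positive₁ = subst (+ 1 ≤_) (sym lookup₁) pos₁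
    ; positive₂ = subst (+ 1 ≤_) (sym lookup₂) pos₂
    ; positive₃ = subst (+ 1 ≤_) (sym lookup₃) pos₃
    ; equation  = trans (trans value sum)
                    (sym (cong₂ _+_ (cong₂ _+_ (via lookup₁ res₁) (via lookup₂ res₂)) (via lookup₃ res₃)))
    }
    where
      via : ∀ {i v w} → F (n - i) ≡ v → F (n - v) ≡ w → F (n - F (n - i)) ≡ w
      via lookup res = trans (cong (λ v → F (n - v)) lookup) res

  summandVia : ∀ {n i} v w → F (n - + i) ≡ v → + 1 ≤ v → F (n - v) ≡ w → Summand n i w
  summandVia v _ = mkSummand v

  zeroSummand : ∀ {n i} v → F (n - + i) ≡ v → + 1 ≤ n → n ≤ v → Summand n i (+ 0)
  zeroSummand v lookup 1≤n n≤v = mkSummand v lookup (ℤ.≤-trans 1≤n n≤v) (F-nonpos (ℤ.i≤j⇒i-j≤0 n≤v))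

  -- v = n - y is positive because y ≤ K < n.
  identitySummand : ∀ {n i} v y → K + + 1 ≤ n → F (n - + i) ≡ v → n - v ≡ y → + 1 ≤ y → y ≤ K →
                    Summand n i y
  identitySummand {n} v _ K+1≤n lookup refl 1≤y y≤K = mkSummand v lookup 1≤v (F-identity 1≤y y≤K)
    where
      y+1≤n : n - v + + 1 ≤ n
      y+1≤n = ℤ.≤-trans (ℤ.+-monoˡ-≤ (+ 1) y≤K) K+1≤n
      1≤v : + 1 ≤ v
      1≤v = ≤-transfer y+1≤n (solve (n ∷ v ∷ []))

  atK+1 : ∀ {x} → x ≡ K + + 1 → F x ≡ + 6
  atK+1 refl = F-K+1

  1≤K : + 1 ≤ K
  1≤K = ℤ.≤-trans (+≤+ (s≤s z≤n)) 2≤K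

  1≤K-1 : + 1 ≤ K - + 1
  1≤K-1 = ≤-transfer 2≤K (solve (K ∷ []))

  F-previous : ∀ k r → + 0 ≤ k → 4 ℕ.≤ toℕ r →
               F (K + L + + 5 + + 7 * (k - + 1) + + toℕ r) ≡ closedForm K L l m (k - + 1) r
  F-previous (+ zero)  r _ 4≤r = F-initial r 4≤r
  F-previous (+ suc k) r _ _   = F-periodic (+ k) r (+≤+ z≤n)

  module _ (k : ℤ) (0≤k : + 0 ≤ k) where

    inBlock : ∀ {x} r → x ≡ K + L + + 5 + + 7 * k + + toℕ r → F x ≡ closedForm K L l m k r
    inBlock r refl = F-periodic k r 0≤k

    inPreviousBlock : ∀ {x} r → 4 ℕ.≤ toℕ r → x ≡ K + L + + 5 + + 7 * (k - + 1) + + toℕ r →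
                      F x ≡ closedForm K L l m (k - + 1) r
    inPreviousBlock r 4≤r refl = F-previous k r 0≤k 4≤r

    d≤L+7k+d : ∀ d → + d ≤ L + + 7 * k + + d
    d≤L+7k+d d = ℤ.+-monoˡ-≤ (+ d) {+ 0} (ℤ.+-mono-≤ 0≤L (ℤ.*-monoˡ-≤-nonNeg (+ 7) 0≤k))

    1≤L+7k+1+d : ∀ d → + 1 ≤ L + + 7 * k + + suc d
    1≤L+7k+1+d d = ℤ.≤-trans (+≤+ (s≤s z≤n)) (d≤L+7k+d (suc d))

    K+1≤n : ∀ r → K + + 1 ≤ K + L + + 5 + + 7 * k + + r
    K+1≤n r = ≤-transfer (ℤ.≤-trans (+≤+ z≤n) (d≤L+7k+d (4 ℕ.+ r))) (regroup (+ r))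
      where
        regroup : ∀ s → K + L + + 5 + + 7 * k + s - (K + + 1) ≡ L + + 7 * k + (+ 4 + s) - + 0
        regroup s = solve (K ∷ L ∷ k ∷ s ∷ [])

    1≤n : ∀ r → + 1 ≤ K + L + + 5 + + 7 * k + + r
    1≤n r = ℤ.≤-trans (ℤ.+-monoˡ-≤ (+ 1) (ℤ.≤-trans (+≤+ z≤n) 2≤K)) (K+1≤n r)

    recurrence₀ : L + + 7 * k + + 7 ≤ K →
                  K + L + + 5 + + 7 * k + + 0 ≤ + 2 * K + (k - + 1) + m →
                  K + L + + 5 + + 7 * k + + 0 ≤ + 2 * K + + 2 * (k - + 1) + l →
                  RecurrenceAt F (K + L + + 5 + + 7 * k + + 0)
    recurrence₀ room roomᵐ roomˡ = fromSummands
      (identitySummand (K - + 2) (L + + 7 * k + + 7) (K+1≤n 0)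
        (inPreviousBlock (# 6) (ℕ.m≤m+n 4 _) (solve (K ∷ L ∷ k ∷ []))) (solve (K ∷ L ∷ k ∷ []))
        (1≤L+7k+1+d 6) room)
      (zeroSummand (+ 2 * K + (k - + 1) + m)
        (inPreviousBlock (# 5) (ℕ.m≤m+n 4 _) (solve (K ∷ L ∷ k ∷ []))) (1≤n 0) roomᵐ)
      (zeroSummand (+ 2 * K + + 2 * (k - + 1) + l)
        (inPreviousBlock (# 4) (ℕ.m≤m+n 4 _) (solve (K ∷ L ∷ k ∷ []))) (1≤n 0) roomˡ)
      (L + + 7 * k + + 7) (inBlock (# 0) refl) (solve (L ∷ k ∷ []))

    recurrence₁ : L + + 7 * k + + 8 ≤ K →
                  K + L + + 5 + + 7 * k + + 1 ≤ + 2 * K + (k - + 1) + m →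
                  RecurrenceAt F (K + L + + 5 + + 7 * k + + 1)
    recurrence₁ room roomᵐ = fromSummands
      (identitySummand (L + + 7 * k + + 7) (K - + 1) (K+1≤n 1)
        (inBlock (# 0) (solve (K ∷ L ∷ k ∷ []))) (solve (K ∷ L ∷ k ∷ [])) 1≤K-1 (ℤ.i-j≤i K (+ 1)))
      (identitySummand (K - + 2) (L + + 7 * k + + 8) (K+1≤n 1)
        (inPreviousBlock (# 6) (ℕ.m≤m+n 4 _) (solve (K ∷ L ∷ k ∷ []))) (solve (K ∷ L ∷ k ∷ []))
        (1≤L+7k+1+d 7) room)
      (zeroSummand (+ 2 * K + (k - + 1) + m)
        (inPreviousBlock (# 5) (ℕ.m≤m+n 4 _) (solve (K ∷ L ∷ k ∷ []))) (1≤n 1) roomᵐ)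
      (K + L + + 5 + + 7 * k + + 2) (inBlock (# 1) refl) (solve (K ∷ L ∷ k ∷ []))

    recurrence₂ : L + + 7 * k + + 9 ≤ K → RecurrenceAt F (K + L + + 5 + + 7 * k + + 2)
    recurrence₂ room = fromSummands
      (zeroSummand (K + L + + 5 + + 7 * k + + 2)
        (inBlock (# 1) (solve (K ∷ L ∷ k ∷ []))) (1≤n 2) ℤ.≤-refl)
      (identitySummand (L + + 7 * k + + 7) K (K+1≤n 2)
        (inBlock (# 0) (solve (K ∷ L ∷ k ∷ []))) (solve (K ∷ L ∷ k ∷ [])) 1≤K ℤ.≤-refl)
      (identitySummand (K - + 2) (L + + 7 * k + + 9) (K+1≤n 2)
        (inPreviousBlock (# 6) (ℕ.m≤m+n 4 _) (solve (K ∷ L ∷ k ∷ []))) (solve (K ∷ L ∷ k ∷ []))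
        (1≤L+7k+1+d 8) room)
      (K + L + + 5 + + 7 * k + + 4) (inBlock (# 2) refl) (solve (K ∷ L ∷ k ∷ []))

    recurrence₃ : RecurrenceAt F (K + L + + 5 + + 7 * k + + 3)
    recurrence₃ = fromSummands
      (zeroSummand (K + L + + 5 + + 7 * k + + 4)
        (inBlock (# 2) (solve (K ∷ L ∷ k ∷ []))) (1≤n 3)
        (≤-transfer (+≤+ {0} {1} z≤n) (solve (K ∷ L ∷ k ∷ []))))
      (identitySummand (K + L + + 5 + + 7 * k + + 2) (+ 1) (K+1≤n 3)
        (inBlock (# 1) (solve (K ∷ L ∷ k ∷ []))) (solve (K ∷ L ∷ k ∷ [])) ℤ.≤-refl 1≤K)
      (summandVia (L + + 7 * k + + 7) (+ 6)
        (inBlock (# 0) (solve (K ∷ L ∷ k ∷ []))) (1≤L+7k+1+d 6)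
        (atK+1 (solve (K ∷ L ∷ k ∷ []))))
      (+ 7) (inBlock (# 3) refl) refl

    recurrence₄ : RecurrenceAt F (K + L + + 5 + + 7 * k + + 4)
    recurrence₄ = fromSummands
      (summandVia (+ 7) (+ 2 * K + + 2 * (k - + 1) + l)
        (inBlock (# 3) (solve (K ∷ L ∷ k ∷ []))) (+≤+ (s≤s z≤n))
        (inPreviousBlock (# 4) (ℕ.m≤m+n 4 _) (solve (K ∷ L ∷ k ∷ []))))
      (zeroSummand (K + L + + 5 + + 7 * k + + 4)
        (inBlock (# 2) (solve (K ∷ L ∷ k ∷ []))) (1≤n 4) ℤ.≤-refl)
      (identitySummand (K + L + + 5 + + 7 * k + + 2) (+ 2) (K+1≤n 4)
        (inBlock (# 1) (solve (K ∷ L ∷ k ∷ []))) (solve (K ∷ L ∷ k ∷ [])) (+≤+ (s≤s z≤n)) 2≤K)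
      (+ 2 * K + + 2 * k + l) (inBlock (# 4) refl) (solve (K ∷ k ∷ l ∷ []))

    recurrence₅ : K + L + + 5 + + 7 * k + + 5 ≤ + 2 * K + + 2 * k + l → RecurrenceAt F (K + L + + 5 + + 7 * k + + 5)
    recurrence₅ roomˡ = fromSummands
      (zeroSummand (+ 2 * K + + 2 * k + l)
        (inBlock (# 4) (solve (K ∷ L ∷ k ∷ []))) (1≤n 5) roomˡ)
      (summandVia (+ 7) (+ 2 * K + (k - + 1) + m)
        (inBlock (# 3) (solve (K ∷ L ∷ k ∷ []))) (+≤+ (s≤s z≤n))
        (inPreviousBlock (# 5) (ℕ.m≤m+n 4 _) (solve (K ∷ L ∷ k ∷ []))))
      (identitySummand (K + L + + 5 + + 7 * k + + 4) (+ 1) (K+1≤n 5)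
        (inBlock (# 2) (solve (K ∷ L ∷ k ∷ []))) (solve (K ∷ L ∷ k ∷ [])) ℤ.≤-refl 1≤K)
      (+ 2 * K + k + m) (inBlock (# 5) refl) (solve (K ∷ k ∷ m ∷ []))

    recurrence₆ : K + L + + 5 + + 7 * k + + 6 ≤ + 2 * K + k + m →
                  K + L + + 5 + + 7 * k + + 6 ≤ + 2 * K + + 2 * k + l →
                  RecurrenceAt F (K + L + + 5 + + 7 * k + + 6)
    recurrence₆ roomᵐ roomˡ = fromSummands
      (zeroSummand (+ 2 * K + k + m)
        (inBlock (# 5) (solve (K ∷ L ∷ k ∷ []))) (1≤n 6) roomᵐ)
      (zeroSummand (+ 2 * K + + 2 * k + l)
        (inBlock (# 4) (solve (K ∷ L ∷ k ∷ []))) (1≤n 6) roomˡ)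
      (summandVia (+ 7) (K - + 2)
        (inBlock (# 3) (solve (K ∷ L ∷ k ∷ []))) (+≤+ (s≤s z≤n))
        (inPreviousBlock (# 6) (ℕ.m≤m+n 4 _) (solve (K ∷ L ∷ k ∷ []))))
      (K - + 2) (inBlock (# 6) refl) (solve (K ∷ []))

module Solution (K L : ℕ) (a : Vec ℤ L) (l m : ℤ) where

  init : List ℤ
  init = initial K L a l m

  identityPart : List ℤ
  identityPart = map (λ i → + suc i) (upTo K)

  lastThree : List ℤ
  lastThree = (+ 2 * + K + l - + 2) ∷ (+ 2 * + K + m - + 1) ∷ (+ K - + 2) ∷ []

  length-identityPart : length identityPart ≡ K
  length-identityPart = trans (length-map _ (upTo K)) (length-upTo K)

  length-init : length init ≡ K ℕ.+ L ℕ.+ 4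
  length-init = begin
    length init
      ≡⟨ length-++ identityPart ⟩
    length identityPart ℕ.+ suc (length (Vec.toList a ++ lastThree))
      ≡⟨ cong₂ (λ x y → x ℕ.+ suc y) length-identityPart (length-++ (Vec.toList a)) ⟩
    K ℕ.+ suc (length (Vec.toList a) ℕ.+ 3)
      ≡⟨ cong (λ y → K ℕ.+ suc (y ℕ.+ 3)) (length-toList a) ⟩
    K ℕ.+ suc (L ℕ.+ 3)
      ≡⟨ ℕ-Solver.solve (K ∷ L ∷ []) ⟩
    K ℕ.+ L ℕ.+ 4 ∎
    where open ≡-Reasoning

  nth-init-identity : ∀ {j} → j ℕ.< K → nth init j ≡ just (+ suc j)
  nth-init-identity {j} j<K = begin
    nth init j                          ≡⟨ nth-++ˡ identityPart _ (subst (j ℕ.<_) (sym length-identityPart) j<K) ⟩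
    nth identityPart j                  ≡⟨ cong (λ xs → nth xs j) (map-upTo _ K) ⟩
    nth (applyUpTo (λ i → + suc i) K) j ≡⟨ nth-applyUpTo _ j<K ⟩
    just (+ suc j)                      ∎
    where open ≡-Reasoning

  nth-init-after : ∀ j → nth init (K ℕ.+ j) ≡ nth (+ 6 ∷ Vec.toList a ++ lastThree) j
  nth-init-after j = subst (λ k → nth init (k ℕ.+ j) ≡ nth (+ 6 ∷ Vec.toList a ++ lastThree) j) length-identityPart
    (nth-++ʳ identityPart (+ 6 ∷ Vec.toList a ++ lastThree) j)

  nth-init-K : nth init K ≡ just (+ 6)
  nth-init-K = subst (λ k → nth init k ≡ just (+ 6)) (ℕ.+-identityʳ K) (nth-init-after 0)

  nth-init-last : ∀ i → nth init (K ℕ.+ suc (L ℕ.+ i)) ≡ nth lastThree i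
  nth-init-last i = trans (nth-init-after (suc (L ℕ.+ i)))
    (subst (λ k → nth (Vec.toList a ++ lastThree) (k ℕ.+ i) ≡ nth lastThree i) (length-toList a)
      (nth-++ʳ (Vec.toList a) lastThree i))

  periodic : ℕ → ℤ
  periodic u = closedForm (+ K) (+ L) l m (+ (u / 7)) (u mod 7)

  -- F (M + u) = periodic u for M = K + L + 5 = length init + 1; before that, F follows init.
  F : ℤ → ℤ
  F (+ suc j)  = fromMaybe (periodic (j ℕ.∸ (K ℕ.+ L ℕ.+ 4))) (nth init j)
  F (+ zero)   = + 0
  F -[1+ _ ]   = + 0

  F-nonpos : VanishesOnNonpositive F
  F-nonpos {+ zero}    _        = refl
  F-nonpos { -[1+ _ ]} _        = refl
  F-nonpos {+ suc _}   (+≤+ ())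

  F-init : ∀ {j} → j ℕ.< length init → nth init j ≡ just (F (+ suc j))
  F-init = nth≡just-fromMaybe init _

  F-identity : ∀ {x} → + 1 ≤ x → x ≤ + K → F x ≡ x
  F-identity {+ zero}  (+≤+ ()) _
  F-identity {+ suc j} _ (+≤+ j<K) rewrite nth-init-identity j<K = refl

  F-K+1 : F (+ K + + 1) ≡ + 6
  F-K+1 rewrite ℕ.+-comm K 1 | nth-init-K = refl

  index≡ : ∀ q (r : Fin 7) → + K + + L + + 5 + + 7 * + q + + toℕ r ≡ + suc (K ℕ.+ L ℕ.+ 4 ℕ.+ (toℕ r ℕ.+ q ℕ.* 7))
  index≡ q r = trans (cong (λ z → + K + + L + + 5 + z + + toℕ r) (sym (ℤ.pos-* 7 q))) (cong +_ (regroup (toℕ r)))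
    where
      regroup : ∀ s → K ℕ.+ L ℕ.+ 5 ℕ.+ 7 ℕ.* q ℕ.+ s ≡ suc (K ℕ.+ L ℕ.+ 4 ℕ.+ (s ℕ.+ q ℕ.* 7))
      regroup s = ℕ-Solver.solve (K ∷ L ∷ q ∷ s ∷ [])

  F-periodic : ∀ k r → + 0 ≤ k → F (+ K + + L + + 5 + + 7 * k + + toℕ r) ≡ closedForm (+ K) (+ L) l m k r
  F-periodic (+ q) r _ = begin
    F (+ K + + L + + 5 + + 7 * + q + + toℕ r)
      ≡⟨ cong F (index≡ q r) ⟩
    fromMaybe (periodic (K ℕ.+ L ℕ.+ 4 ℕ.+ u ℕ.∸ (K ℕ.+ L ℕ.+ 4))) (nth init (K ℕ.+ L ℕ.+ 4 ℕ.+ u))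
      ≡⟨ cong (fromMaybe _) (nth-≥length init (subst (ℕ._≤ K ℕ.+ L ℕ.+ 4 ℕ.+ u) (sym length-init) (ℕ.m≤m+n _ u))) ⟩
    periodic (K ℕ.+ L ℕ.+ 4 ℕ.+ u ℕ.∸ (K ℕ.+ L ℕ.+ 4))
      ≡⟨ cong periodic (ℕ.m+n∸m≡n (K ℕ.+ L ℕ.+ 4) u) ⟩
    periodic u
      ≡⟨ cong₂ (λ q′ r′ → closedForm (+ K) (+ L) l m (+ q′) r′) ([r+q*7]/7≡q q r) ([r+q*7]mod7≡r q r) ⟩
    closedForm (+ K) (+ L) l m (+ q) r ∎
    where
      open ≡-Reasoning
      u = toℕ r ℕ.+ q ℕ.* 7

  F-lastThree : ∀ i → F (+ K + + L + + 5 + + 7 * -[1+ 0 ] + + (4 ℕ.+ i)) ≡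
                      fromMaybe (periodic (K ℕ.+ suc (L ℕ.+ i) ℕ.∸ (K ℕ.+ L ℕ.+ 4))) (nth lastThree i)
  F-lastThree i =
    trans (cong F (trans (back (+ K + + L) (+ i)) (cong +_ (regroup i)))) (cong (fromMaybe _) (nth-init-last i))
    where
      back : ∀ x y → x + + 5 + + 7 * -[1+ 0 ] + (+ 4 + y) ≡ x + (+ 2 + y)
      back = solve-∀
      regroup : ∀ i → K ℕ.+ L ℕ.+ (2 ℕ.+ i) ≡ suc (K ℕ.+ suc (L ℕ.+ i))
      regroup i = ℕ-Solver.solve (K ∷ L ∷ i ∷ [])

  F-initial : ∀ r → 4 ℕ.≤ toℕ r →
              F (+ K + + L + + 5 + + 7 * -[1+ 0 ] + + toℕ r) ≡ closedForm (+ K) (+ L) l m -[1+ 0 ] r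
  F-initial (suc (suc (suc (suc zero))))             _ = trans (F-lastThree 0) (twice (+ K) l)
    where twice : ∀ x y → + 2 * x + y - + 2 ≡ + 2 * x + + 2 * -[1+ 0 ] + y
          twice = solve-∀
  F-initial (suc (suc (suc (suc (suc zero)))))       _ = trans (F-lastThree 1) (once (+ K) m)
    where once : ∀ x y → + 2 * x + y - + 1 ≡ + 2 * x + -[1+ 0 ] + y
          once = solve-∀
  F-initial (suc (suc (suc (suc (suc (suc zero)))))) _ = F-lastThree 2
  F-initial (suc zero)                               (s≤s ())
  F-initial (suc (suc zero))                         (s≤s (s≤s ()))
  F-initial (suc (suc (suc zero)))                   (s≤s (s≤s (s≤s ())))

-- Arithmetic of the range

-- ν′ γ is the largest residue r such that M + 7 (c - 1) + r ≤ 2K + ν γ.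
λ₀′ μ₀′ ν′ : Fin 7 → ℕ
λ₀′ zero           = 2
λ₀′ (suc zero)     = 2
λ₀′ (suc (suc _))  = 6
μ₀′ zero           = 0
μ₀′ (suc zero)     = 1
μ₀′ (suc (suc _))  = 5
ν′ zero            = 0
ν′ (suc zero)      = 1
ν′ (suc (suc _))   = 6

λ₀≡ : ∀ γ → λ₀ γ ≡ + λ₀′ γ - + toℕ γ
λ₀≡ zero = refl
λ₀≡ (suc zero) = refl
λ₀≡ (suc (suc zero)) = refl
λ₀≡ (suc (suc (suc zero))) = refl
λ₀≡ (suc (suc (suc (suc zero)))) = refl
λ₀≡ (suc (suc (suc (suc (suc zero))))) = refl
λ₀≡ (suc (suc (suc (suc (suc (suc zero)))))) = refl

μ₀≡ : ∀ γ → μ₀ γ ≡ + μ₀′ γ - + toℕ γ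
μ₀≡ zero = refl
μ₀≡ (suc zero) = refl
μ₀≡ (suc (suc zero)) = refl
μ₀≡ (suc (suc (suc zero))) = refl
μ₀≡ (suc (suc (suc (suc zero)))) = refl
μ₀≡ (suc (suc (suc (suc (suc zero))))) = refl
μ₀≡ (suc (suc (suc (suc (suc (suc zero)))))) = refl

ν≡ : ∀ γ → ν γ ≡ + ν′ γ - + toℕ γ - + 2
ν≡ zero = refl
ν≡ (suc zero) = refl
ν≡ (suc (suc zero)) = refl
ν≡ (suc (suc (suc zero))) = refl
ν≡ (suc (suc (suc (suc zero)))) = refl
ν≡ (suc (suc (suc (suc (suc zero))))) = refl
ν≡ (suc (suc (suc (suc (suc (suc zero)))))) = refl

ν′≤6 : ∀ γ → ν′ γ ℕ.≤ 6
ν′≤6 zero          = z≤n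
ν′≤6 (suc zero)    = s≤s z≤n
ν′≤6 (suc (suc _)) = ℕ.≤-refl

7≰6 : ¬ 7 ℕ.≤ 6
7≰6 = ℕ.<⇒≱ (ℕ.n<1+n 6)

block-split : ∀ q c {s t} → t ℕ.≤ 6 → q ℕ.* 7 ℕ.+ s ℕ.+ 7 ℕ.≤ c ℕ.* 7 ℕ.+ t →
              Σ[ e ∈ ℕ ] c ≡ suc (q ℕ.+ e) × s ℕ.≤ t ℕ.+ e ℕ.* 7
block-split zero    zero    {s} t≤6 h = ⊥-elim (7≰6 (ℕ.≤-trans (ℕ.≤-trans (ℕ.m≤n+m 7 s) h) t≤6))
block-split zero    (suc c) {s} {t} _ h =
  c , refl , subst (s ℕ.≤_) (ℕ.+-comm (c ℕ.* 7) t)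
                (ℕ.+-cancelˡ-≤ 7 s _ (subst (ℕ._≤ 7 ℕ.+ (c ℕ.* 7 ℕ.+ t)) (ℕ.+-comm s 7) h))
block-split (suc q) zero    t≤6 h = ⊥-elim (7≰6 (ℕ.≤-trans (ℕ.≤-trans (ℕ.m≤m+n 7 _) h) t≤6))
block-split (suc q) (suc c) t≤6 (s≤s (s≤s (s≤s (s≤s (s≤s (s≤s (s≤s h))))))) with block-split q c t≤6 h
... | e , refl , s≤ = e , refl , s≤

block-bound : ∀ {K L c g q s t ν₀} → K ≡ L + + 7 * c + g → ν₀ ≡ t - g - + 2 →
              K + L + + 5 + + 7 * q + s ≤ + 2 * K + ν₀ → q * + 7 + s + + 7 ≤ c * + 7 + t
block-bound {L = L} {c} {g} {q} {s} {t} refl refl n≤end =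
  ≤-transfer n≤end (solve (L ∷ c ∷ g ∷ q ∷ s ∷ t ∷ []))

μ-bound : ∀ {K L c g q s d v′ v m} → K ≡ L + + 7 * c + g → v ≡ v′ - g → v - c ≤ m →
          + 6 * q + (+ 5 + s + d) ≤ + 6 * c + v′ → K + L + + 5 + + 7 * q + s ≤ + 2 * K + (q - d) + m
μ-bound {L = L} {c} {g} {q} {s} {d} {v′} {m = m} refl refl v≤m room =
  ≤-transfer (ℤ.+-mono-≤ room v≤m) (solve (L ∷ c ∷ g ∷ q ∷ s ∷ d ∷ v′ ∷ m ∷ []))

λ-bound : ∀ {K L c g q s d v′ v l} → K ≡ L + + 7 * c + g → v ≡ v′ - g → v - + 2 * c ≤ l →
          + 5 * q + (+ 5 + s + d + d) ≤ + 5 * c + v′ → K + L + + 5 + + 7 * q + s ≤ + 2 * K + + 2 * (q - d) + l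
λ-bound {L = L} {c} {g} {q} {s} {d} {v′} {l = l} refl refl v≤l room =
  ≤-transfer (ℤ.+-mono-≤ room v≤l) (solve (L ∷ c ∷ g ∷ q ∷ s ∷ d ∷ v′ ∷ l ∷ []))

block-room : ∀ n q e {x y} → x ℕ.≤ n ℕ.+ (y ℕ.+ e ℕ.* n) → n ℕ.* q ℕ.+ x ℕ.≤ n ℕ.* suc (q ℕ.+ e) ℕ.+ y
block-room n q e {x} {y} x≤ = subst (n ℕ.* q ℕ.+ x ℕ.≤_) regroup (ℕ.+-monoʳ-≤ (n ℕ.* q) x≤)
  where
    regroup : n ℕ.* q ℕ.+ (n ℕ.+ (y ℕ.+ e ℕ.* n)) ≡ n ℕ.* suc (q ℕ.+ e) ℕ.+ y
    regroup = ℕ-Solver.solve (n ∷ q ∷ e ∷ y ∷ [])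

-- e is the number of further blocks in range after block q; for e = 0 the bound is a table fact.
identity-room : ∀ γ e {r} → r ℕ.≤ 2 → r ℕ.≤ ν′ γ ℕ.+ e ℕ.* 7 → r ℕ.≤ toℕ γ ℕ.+ e ℕ.* 7
identity-room γ             (suc e) r≤2 _  = ℕ.≤-trans r≤2 (ℕ.≤-trans (ℕ.m≤m+n 2 _) (ℕ.m≤n+m _ (toℕ γ)))
identity-room zero          zero    _   r≤ = r≤
identity-room (suc zero)    zero    _   r≤ = r≤
identity-room (suc (suc γ)) zero    r≤2 _  = ℕ.≤-trans r≤2 (ℕ.m≤m+n 2 _)

μ-room : ∀ γ e {r d} → d ℕ.≤ 1 → r ℕ.+ d ℕ.≤ 6 → r ℕ.≤ ν′ γ ℕ.+ e ℕ.* 7 →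
         r ℕ.+ d ℕ.≤ suc (μ₀′ γ ℕ.+ e ℕ.* 6)
μ-room γ             (suc e) _   ≤6 _  = ℕ.≤-trans ≤6 (ℕ.≤-trans (ℕ.m≤m+n 6 _) (ℕ.m≤n+m _ (suc (μ₀′ γ))))
μ-room zero          zero    d≤1 _  r≤ = ℕ.+-mono-≤ r≤ d≤1
μ-room (suc zero)    zero    d≤1 _  r≤ = ℕ.+-mono-≤ r≤ d≤1
μ-room (suc (suc γ)) zero    _   ≤6 _  = ≤6

2≤λ₀′ : ∀ γ → 2 ℕ.≤ λ₀′ γ
2≤λ₀′ zero          = s≤s (s≤s z≤n)
2≤λ₀′ (suc zero)    = s≤s (s≤s z≤n)
2≤λ₀′ (suc (suc γ)) = s≤s (s≤s z≤n)

λ-room : ∀ γ e {r} → r ℕ.≤ 6 → r ℕ.≤ ν′ γ ℕ.+ e ℕ.* 7 → r ℕ.≤ λ₀′ γ ℕ.+ e ℕ.* 5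
λ-room γ             (suc e) ≤6 _  =
  ℕ.≤-trans ≤6 (ℕ.+-mono-≤ (ℕ.≤-trans (s≤s z≤n) (2≤λ₀′ γ)) (ℕ.m≤m+n 5 (e ℕ.* 5)))
λ-room zero          zero    _  r≤ = ℕ.≤-trans r≤ z≤n
λ-room (suc zero)    zero    _  r≤ = ℕ.≤-trans r≤ (s≤s z≤n)
λ-room (suc (suc γ)) zero    ≤6 _  = ≤6

-k*7≤s+3 : ∀ {M k s} → M - + 3 ≤ M + + 7 * k + s → - k * + 7 ≤ s + + 3
-k*7≤s+3 {M} {k} {s} start≤n = ≤-transfer start≤n (solve (M ∷ k ∷ s ∷ []))

block-of-term : ∀ {M} k (r : Fin 7) → M - + 3 ≤ M + + 7 * k + + toℕ r → + 0 ≤ k ⊎ (k ≡ -[1+ 0 ] × 4 ℕ.≤ toℕ r)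
block-of-term     (+ _)        r _       = inj₁ (+≤+ z≤n)
block-of-term {M} -[1+ zero ]  r start≤n =
  inj₂ (refl , ℕ.+-cancelʳ-≤ 3 4 (toℕ r) (ℤ.drop‿+≤+ (-k*7≤s+3 {M} { -[1+ 0 ]} start≤n)))
block-of-term {M} -[1+ suc k ] r start≤n = ⊥-elim (ℕ.<⇒≱ (ℕ.m<m+n 9 (s≤s z≤n)) 14≤9)
  where
    14≤9 : 14 ℕ.≤ 9
    14≤9 = ℕ.≤-trans (ℕ.≤-trans (ℕ.m≤m+n 14 _) (ℤ.drop‿+≤+ (-k*7≤s+3 {M} { -[1+ suc k ]} start≤n)))
                     (ℕ.+-monoˡ-≤ 3 (Fin.toℕ≤pred[n] r))

module InRange (L c : ℕ) (γ : Fin 7) (a : Vec ℤ L) (l m : ℤ)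
  (2≤K : 2 ℕ.≤ L ℕ.+ 7 ℕ.* c ℕ.+ toℕ γ) (λ₀≤l : λ₀ γ - + 2 * + c ≤ l) (μ₀≤m : μ₀ γ - + c ≤ m) where

  K : ℕ
  K = L ℕ.+ 7 ℕ.* c ℕ.+ toℕ γ

  open Solution K L a l m public
  open BlockRecurrence F (+ K) (+ L) l m (+≤+ z≤n) (+≤+ 2≤K) F-nonpos F-identity F-K+1 F-initial F-periodic

  +K≡ : + K ≡ + L + + 7 * + c + + toℕ γ
  +K≡ = cong (λ z → + L + z + + toℕ γ) (ℤ.pos-* 7 c)

  residue-bound : ∀ q (r : Fin 7) → + K + + L + + 5 + + 7 * + q + + toℕ r ≤ + 2 * + K + ν γ →
                  q ℕ.* 7 ℕ.+ toℕ r ℕ.+ 7 ℕ.≤ c ℕ.* 7 ℕ.+ ν′ γ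
  residue-bound q r n≤end = ℤ.drop‿+≤+ (subst₂ _≤_ (sym (cong (λ z → z + + toℕ r + + 7) (ℤ.pos-* q 7)))
    (sym (+[a*b+y] c 7 (ν′ γ))) (block-bound {L = + L} {+ c} {+ toℕ γ} {+ q} {+ toℕ r} +K≡ (ν≡ γ) n≤end))

  module _ q e (c≡ : c ≡ suc (q ℕ.+ e)) where

    identity-side : ∀ {x} → x ℕ.≤ toℕ γ ℕ.+ e ℕ.* 7 → + L + + 7 * + q + + (7 ℕ.+ x) ≤ + K
    identity-side {x} x≤ = subst (_≤ + K) (cong (λ z → + L + z + + (7 ℕ.+ x)) (ℤ.pos-* 7 q))
      (+≤+ (subst₂ ℕ._≤_ (sym (ℕ.+-assoc L _ _)) (sym (ℕ.+-assoc L _ _))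
        (ℕ.+-monoʳ-≤ L (subst (λ c → 7 ℕ.* q ℕ.+ (7 ℕ.+ x) ℕ.≤ 7 ℕ.* c ℕ.+ toℕ γ) (sym c≡)
          (block-room 7 q e (ℕ.+-monoʳ-≤ 7 x≤))))))

    μ-side : ∀ {s d} → s ℕ.+ d ℕ.≤ suc (μ₀′ γ ℕ.+ e ℕ.* 6) →
             + K + + L + + 5 + + 7 * + q + + s ≤ + 2 * + K + (+ q - + d) + m
    μ-side {s} {d} room = μ-bound {L = + L} {+ c} {+ toℕ γ} {+ q} {+ s} {+ d} +K≡ (μ₀≡ γ) μ₀≤m
      (subst₂ _≤_ (+[a*b+y] 6 q _) (+[a*b+y] 6 c _)
        (+≤+ (subst (λ c → 6 ℕ.* q ℕ.+ (5 ℕ.+ s ℕ.+ d) ℕ.≤ 6 ℕ.* c ℕ.+ μ₀′ γ) (sym c≡)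
          (block-room 6 q e (ℕ.+-monoʳ-≤ 5 room)))))

    λ-side : ∀ {s d} → s ℕ.+ d ℕ.+ d ℕ.≤ λ₀′ γ ℕ.+ e ℕ.* 5 →
             + K + + L + + 5 + + 7 * + q + + s ≤ + 2 * + K + + 2 * (+ q - + d) + l
    λ-side {s} {d} room = λ-bound {L = + L} {+ c} {+ toℕ γ} {+ q} {+ s} {+ d} +K≡ (λ₀≡ γ) λ₀≤l
      (subst₂ _≤_ (+[a*b+y] 5 q _) (+[a*b+y] 5 c _)
        (+≤+ (subst (λ c → 5 ℕ.* q ℕ.+ (5 ℕ.+ s ℕ.+ d ℕ.+ d) ℕ.≤ 5 ℕ.* c ℕ.+ λ₀′ γ) (sym c≡)
          (block-room 5 q e (ℕ.+-monoʳ-≤ 5 room)))))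

    recurrence-at : ∀ (r : Fin 7) → toℕ r ℕ.≤ ν′ γ ℕ.+ e ℕ.* 7 →
                    RecurrenceAt F (+ K + + L + + 5 + + 7 * + q + + toℕ r)
    recurrence-at zero r≤ =
      recurrence₀ (+ q) (+≤+ z≤n) (identity-side z≤n) (μ-side {0} {1} (s≤s z≤n))
        (λ-side {0} {1} (ℕ.≤-trans (2≤λ₀′ γ) (ℕ.m≤m+n _ _)))
    recurrence-at (suc zero) r≤ =
      recurrence₁ (+ q) (+≤+ z≤n) (identity-side (identity-room γ e (s≤s z≤n) r≤))
        (μ-side {1} {1} (μ-room γ e ℕ.≤-refl (s≤s (s≤s z≤n)) r≤))
    recurrence-at (suc (suc zero)) r≤ =
      recurrence₂ (+ q) (+≤+ z≤n) (identity-side (identity-room γ e ℕ.≤-refl r≤))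
    recurrence-at (suc (suc (suc zero))) _ = recurrence₃ (+ q) (+≤+ z≤n)
    recurrence-at (suc (suc (suc (suc zero)))) _ = recurrence₄ (+ q) (+≤+ z≤n)
    recurrence-at (suc (suc (suc (suc (suc zero))))) r≤ =
      recurrence₅ (+ q) (+≤+ z≤n)
        (subst (λ p → + K + + L + + 5 + + 7 * + q + + 5 ≤ + 2 * + K + + 2 * p + l) (ℤ.+-identityʳ (+ q))
          (λ-side {5} {0} (λ-room γ e (ℕ.n≤1+n 5) r≤)))
    recurrence-at (suc (suc (suc (suc (suc (suc zero)))))) r≤ =
      recurrence₆ (+ q) (+≤+ z≤n)
        (subst (λ p → + K + + L + + 5 + + 7 * + q + + 6 ≤ + 2 * + K + p + m) (ℤ.+-identityʳ (+ q))
          (μ-side {6} {0} (μ-room γ e z≤n ℕ.≤-refl r≤)))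
        (subst (λ p → + K + + L + + 5 + + 7 * + q + + 6 ≤ + 2 * + K + + 2 * p + l) (ℤ.+-identityʳ (+ q))
          (λ-side {6} {0} (λ-room γ e ℕ.≤-refl r≤)))

  recurrence-in-range : ∀ q (r : Fin 7) → + K + + L + + 5 + + 7 * + q + + toℕ r ≤ + 2 * + K + ν γ →
                        RecurrenceAt F (+ K + + L + + 5 + + 7 * + q + + toℕ r)
  recurrence-in-range q r n≤end with block-split q c (ν′≤6 γ) (residue-bound q r n≤end)
  ... | e , c≡ , r≤ = recurrence-at q e c≡ r r≤

  recurrence-beyond-initial : ∀ {j} → length init ℕ.≤ j → + suc j ≤ + 2 * + K + ν γ → RecurrenceAt F (+ suc j)
  recurrence-beyond-initial {j} len≤j j≤end =
    subst (RecurrenceAt F) j≡ (recurrence-in-range (u / 7) (u mod 7) (subst (_≤ + 2 * + K + ν γ) (sym j≡) j≤end))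
    where
      u = j ℕ.∸ (K ℕ.+ L ℕ.+ 4)
      j≡ : + K + + L + + 5 + + 7 * + (u / 7) + + toℕ (u mod 7) ≡ + suc j
      j≡ = trans (index≡ (u / 7) (u mod 7))
        (cong (λ v → + suc v) (trans (cong (K ℕ.+ L ℕ.+ 4 ℕ.+_) (sym (u≡[u%7]+[u/7]*7 u)))
          (ℕ.m+[n∸m]≡n (subst (ℕ._≤ j) length-init len≤j))))

  F≡expected : ∀ k r → + (K ℕ.+ L ℕ.+ 5) - + 3 ≤ + (K ℕ.+ L ℕ.+ 5) + + 7 * k + + toℕ r →
               F (+ (K ℕ.+ L ℕ.+ 5) + + 7 * k + + toℕ r) ≡ expected K L l m k r
  F≡expected k r start≤n with block-of-term {+ (K ℕ.+ L ℕ.+ 5)} k r start≤n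
  ... | inj₁ 0≤k          = trans (F-periodic k r 0≤k) (closedForm≡expected K L l m k r)
  ... | inj₂ (refl , 4≤r) = trans (F-initial r 4≤r) (closedForm≡expected K L l m -[1+ 0 ] r)

lemma3 : (K c : ℕ) (γ : Fin 7) → 7 ℕ.≤ K → 1 ℕ.≤ c →
    (l m : ℤ) → λ₀ γ - + 2 * + c ≤ l → μ₀ γ - + c ≤ m →
    (L : ℕ) → K ≡ L ℕ.+ 7 ℕ.* c ℕ.+ toℕ γ →
    (a : Vec ℤ L) →
    (k : ℤ) (r : Fin 7) →
    + (K ℕ.+ L ℕ.+ 5) - + 3 ≤ + (K ℕ.+ L ℕ.+ 5) + + 7 * k + + toℕ r →
    + (K ℕ.+ L ℕ.+ 5) + + 7 * k + + toℕ r ≤ + 2 * + K + ν γ →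
    B (initial K L a l m) (+ (K ℕ.+ L ℕ.+ 5) + + 7 * k + + toℕ r)
      ≡ just (expected K L l m k r)
lemma3 _ c γ 7≤K _ l m λ₀≤l μ₀≤m L refl a k r start≤n n≤end = begin
  B init n     ≡⟨ B≡F F-nonpos F-init (λ len≤j j≤n → recurrence-beyond-initial len≤j (ℤ.≤-trans j≤n n≤end)) ⟩
  just (F n)   ≡⟨ cong just (F≡expected k r start≤n) ⟩
  just (expected _ L l m k r) ∎
  where
    open InRange L c γ a l m (ℕ.≤-trans (s≤s (s≤s z≤n)) 7≤K) λ₀≤l μ₀≤m
    open ≡-Reasoning
    n = + (K ℕ.+ L ℕ.+ 5) + + 7 * k + + toℕ r
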